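{- Let $q$ be a power of a prime $p$ and let $d$ be a divisor of $q-1$ with $d>1$. Let $S_d=\{x^d: x\in\mathbb{F}_q^*\}$. If $A,B\subset\mathbb{F}_q$ satisfy $A+B\subset S_d\cup\{0\}$ and $$\binom{|A|-1+\frac{q-1}{d}}{\frac{q-1}{d}}\not\equiv 0 \pmod p,$$ then $$|A||B|\le \frac{q-1}{d}+|A\cap(-B)|.$$
   Context: $\mathbb{F}_q$ is the finite field with $q$ elements, of characteristic $p$. For sets $A,B\subset\mathbb{F}_q$, $A+B=\{a+b:a\in A,b\in B\}$ and $-B=\{ -b:b\in B\}$. $S_d$ is the subgroup of $\mathbb{F}_q^*$ of order $\frac{q-1}{d}$. -}

module Defs where

open import Data.Nat using (ℕ; zero; suc)
import Data.Nat as ℕ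
open import Data.Bool using (Bool; true; false; _∧_)
open import Data.Fin using (Fin)
open import Data.List using (List; length; filter; allFin)
open import Data.Product using (∃; _×_)
open import Relation.Binary.PropositionalEquality using (_≡_; _≢_)
open import Relation.Nullary.Decidable using (does)
open import Data.Bool.Properties using (T?)
open import Algebra.Structures using (IsCommutativeRing)
open import Function.Bundles using (_↔_; Inverse)

record FiniteField (q : ℕ) : Set₁ where
  infixl 6 _+_
  infixl 7 _*_
  field
    F    : Set
    _+_  : F → F → F
    _*_  : F → F → F
    -_   : F → F
    0#   : F
    1#   : F
    isCommutativeRing : IsCommutativeRing _≡_ _+_ _*_ -_ 0# 1#
    0≢1  : 0# ≢ 1#
    inverse : ∀ x → x ≢ 0# → ∃ λ y → x * y ≡ 1#
    enum : Fin q ↔ F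

  elem : Fin q → F
  elem = Inverse.to enum

  add : F → F → F
  add = _+_

  _^_ : F → ℕ → F
  x ^ zero  = 1#
  x ^ suc n = x * (x ^ n)

  ℕ→F : ℕ → F
  ℕ→F zero    = 0#
  ℕ→F (suc n) = 1# + ℕ→F n

  Subset : Set
  Subset = F → Bool

  ∣_∣ : Subset → ℕ
  ∣ A ∣ = length (filter (λ i → T? (A (elem i))) (allFin q))

  -- -B = { -b : b ∈ B }   (as a predicate: x ∈ -B iff -x ∈ B)
  neg : Subset → Subset
  neg B x = B (- x)

  _∩_ : Subset → Subset → Subset
  (A ∩ B) x = A x ∧ B x

  InS : ℕ → F → Set
  InS d x = ∃ λ y → (y ≢ 0#) × (y ^ d ≡ x)

module Submission where

-- Stepanov's method. Let n = |A| and let (w_a) be the Lagrange weights of A, so that Σ_a w_a g(a)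
-- is the coefficient of X^(n-1) of any g of degree < n. For N = n - 1 + m the polynomial
-- F(X) = Σ_a w_a (X + a)^N - 1 has degree ≤ m, and its coefficient of X^m is the binomial
-- (N choose m), nonzero in F by hypothesis. If b ∈ B then every a + b is 0 or lies in S_d, where
-- x^m = 1; hence the k-th Hasse derivative Σ_a w_a (N choose k) (a + b)^(N-k) of F + 1 at b equals
-- (N choose k) Σ_a w_a (a + b)^(n-1-k), which is the Hasse derivative of 1, for every k < n - 1 and
-- also for k = n - 1 when -b ∉ A. So F vanishes to order n at each b ∈ B, except to order n - 1 when
-- -b ∈ A, and counting these roots against deg F ≤ m gives n|B| - |A ∩ (-B)| ≤ m.

open import Defs
open import Data.Nat as ℕ using (ℕ; zero; suc; _∸_; z≤n; s≤s)
import Data.Nat.Properties as ℕP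
open import Data.Nat.ListAction using (sum)
open import Data.Nat.Primality using (Prime; prime⇒nonZero)
open import Data.Nat.Divisibility using (_∣_; m%n≡0⇒n∣m)
open import Data.Nat.DivMod using (_%_; _/_; m≡m%n+[m/n]*n; m%n<n)
open import Data.Nat.Coprimality using (prime⇒coprime; coprime-Bézout)
open import Data.Nat.GCD using (module Bézout)
open import Data.Nat.Combinatorics using (_C_; nCn≡1; nCk+nC[k+1]≡[n+1]C[k+1]; k>n⇒nCk≡0; nCk≡nC[n∸k])
open import Data.Integer as ℤ using (ℤ; -[1+_]; _⊖_; sign; _◃_)
import Data.Integer.Properties as ℤP
open import Data.Sign as Sign using (Sign)
open import Data.Bool using (Bool; true; false; _∧_; if_then_else_; T)
open import Data.Bool.Properties using (T?; T-≡; ∧-comm)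
import Data.Fin.Properties as FinP
open import Data.List using (List; []; _∷_; map; length; filter; filterᵇ; allFin; foldr)
import Data.List.Properties as ListP
open import Data.List.Membership.Propositional using (_∈_)
open import Data.List.Membership.Propositional.Properties using (∈-map⁺; ∈-map⁻; ∈-allFin; ∈-filter⁺; ∈-filter⁻)
import Data.List.Membership.Setoid.Properties as MembershipSetoid
open import Data.List.Relation.Unary.All as All using (All; []; _∷_)
import Data.List.Relation.Unary.All.Properties as AllP
open import Data.List.Relation.Unary.Any using (here; there)
open import Data.List.Relation.Unary.AllPairs using ([]; _∷_)
open import Data.List.Relation.Unary.Unique.Propositional using (Unique)
import Data.List.Relation.Unary.Unique.Propositional.Properties as Unique
open import Data.List.Relation.Binary.Permutation.Propositional using (_↭_; ↭⇒↭ₛ)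
open import Data.List.Relation.Binary.Permutation.Propositional.Properties using (↭-length; filter-↭)
open import Data.List.Relation.Binary.Permutation.Setoid.Properties using (foldr-commMonoid)
open import Data.List.Relation.Binary.BagAndSetEquality using (∼bag⇒↭)
open import Data.Maybe using (Maybe; just; nothing)
open import Data.Product using (_×_; _,_; proj₁; proj₂)
open import Data.Sum using (_⊎_; inj₁; inj₂)
open import Data.Empty using (⊥-elim)
open import Function using (_∘_; const; Equivalence; Inverse; mk↔ₛ′)
open import Relation.Nullary using (¬_; yes; no)
import Relation.Nullary.Decidable as Dec
open import Relation.Binary.Definitions using (DecidableEquality)
open import Relation.Binary.PropositionalEquality
open import Axiom.UniquenessOfIdentityProofs using (module Decidable⇒UIP)
open import Algebra.Bundles using (CommutativeRing)
open import Algebra.Solver.Ring.AlmostCommutativeRing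
  using (fromCommutativeRing; _-Raw-AlmostCommutative⟶_)

unique-sameMembers⇒↭ : {A : Set} → DecidableEquality A → {xs ys : List A} → Unique xs → Unique ys →
                       (∀ {z} → z ∈ xs → z ∈ ys) → (∀ {z} → z ∈ ys → z ∈ xs) → xs ↭ ys
unique-sameMembers⇒↭ {A} _≟_ uxs uys to from =
  ∼bag⇒↭ (mk↔ₛ′ to from (λ _ → irrelevant uys _ _) (λ _ → irrelevant uxs _ _))
  where irrelevant = MembershipSetoid.unique⇒irrelevant (setoid A) (Decidable⇒UIP.≡-irrelevant _≟_)

filterᵇ-map : {A B : Set} (p : B → Bool) (f : A → B) (xs : List A) →
              filterᵇ p (map f xs) ≡ map f (filterᵇ (p ∘ f) xs)
filterᵇ-map p f [] = refl
filterᵇ-map p f (x ∷ xs) with p (f x)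
... | true  = cong (f x ∷_) (filterᵇ-map p f xs)
... | false = filterᵇ-map p f xs

filterᵇ-filterᵇ : {A : Set} (p r : A → Bool) (xs : List A) →
                  filterᵇ r (filterᵇ p xs) ≡ filterᵇ (λ x → p x ∧ r x) xs
filterᵇ-filterᵇ p r [] = refl
filterᵇ-filterᵇ p r (x ∷ xs) with p x
... | false = filterᵇ-filterᵇ p r xs
... | true with r x
...   | true  = cong (x ∷_) (filterᵇ-filterᵇ p r xs)
...   | false = filterᵇ-filterᵇ p r xs

sum-if+length-filterᵇ : {A : Set} (p : A → Bool) (n : ℕ) (xs : List A) →
  sum (map (λ x → if p x then n else suc n) xs) ℕ.+ length (filterᵇ p xs) ≡ suc n ℕ.* length xs
sum-if+length-filterᵇ p n [] = sym (ℕP.*-zeroʳ n)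
sum-if+length-filterᵇ p n (x ∷ xs) with p x
... | true  = begin
  n ℕ.+ s ℕ.+ suc c   ≡⟨ ℕP.+-suc (n ℕ.+ s) c ⟩
  suc (n ℕ.+ s ℕ.+ c) ≡⟨ cong suc (ℕP.+-assoc n s c) ⟩
  suc n ℕ.+ (s ℕ.+ c) ≡⟨ cong (suc n ℕ.+_) (sum-if+length-filterᵇ p n xs) ⟩
  suc n ℕ.+ suc n ℕ.* length xs ≡⟨ ℕP.*-suc (suc n) (length xs) ⟨
  suc n ℕ.* suc (length xs) ∎
  where
  open ≡-Reasoning
  s = sum (map (λ x → if p x then n else suc n) xs)
  c = length (filterᵇ p xs)
... | false = trans (ℕP.+-assoc (suc n) _ _)
                (trans (cong (suc n ℕ.+_) (sum-if+length-filterᵇ p n xs)) (sym (ℕP.*-suc (suc n) (length xs))))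

module _ {q : ℕ} (𝔽 : FiniteField q) where
  open FiniteField 𝔽

  commutativeRing : CommutativeRing _ _
  commutativeRing = record { isCommutativeRing = isCommutativeRing }

  open CommutativeRing commutativeRing
    using (+-assoc; +-comm; *-assoc; *-comm; +-identityˡ; +-identityʳ; *-identityˡ; *-identityʳ;
           distribˡ; distribʳ; zeroˡ; zeroʳ; -‿inverseʳ; *-isCommutativeMonoid)
  open import Algebra.Properties.Ring (CommutativeRing.ring commutativeRing)
    using (-‿distribˡ-*; -‿distribʳ-*; -‿involutive; -0#≈0#; -‿+-comm)

  infixl 6 _−_
  _−_ : F → F → F
  x − y = x + - y

  _≟_ : DecidableEquality F
  x ≟ y = Dec.map′ from-injective (cong (Inverse.from enum))
                   (Inverse.from enum x FinP.≟ Inverse.from enum y)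
    where
    from-injective : ∀ {x y} → Inverse.from enum x ≡ Inverse.from enum y → x ≡ y
    from-injective {x} {y} e = trans (sym (Inverse.strictlyInverseˡ enum x))
                                 (trans (cong elem e) (Inverse.strictlyInverseˡ enum y))

  ℕ→F-+ : ∀ m n → ℕ→F (m ℕ.+ n) ≡ ℕ→F m + ℕ→F n
  ℕ→F-+ zero    n = sym (+-identityˡ _)
  ℕ→F-+ (suc m) n = trans (cong (1# +_) (ℕ→F-+ m n)) (sym (+-assoc _ _ _))

  ℕ→F-* : ∀ m n → ℕ→F (m ℕ.* n) ≡ ℕ→F m * ℕ→F n
  ℕ→F-* zero    n = sym (zeroˡ _)
  ℕ→F-* (suc m) n = begin
    ℕ→F (n ℕ.+ m ℕ.* n)          ≡⟨ ℕ→F-+ n (m ℕ.* n) ⟩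
    ℕ→F n + ℕ→F (m ℕ.* n)        ≡⟨ cong₂ _+_ (sym (*-identityˡ _)) (ℕ→F-* m n) ⟩
    1# * ℕ→F n + ℕ→F m * ℕ→F n   ≡⟨ distribʳ _ _ _ ⟨
    (1# + ℕ→F m) * ℕ→F n         ∎
    where open ≡-Reasoning

  -- The ring solver needs coefficients with decidable equality mapped into F; ℤ serves.
  module ℤ-Coefficients where
    applySign : Sign → F → F
    applySign Sign.+ x = x
    applySign Sign.- x = - x

    ℤ→F : ℤ → F
    ℤ→F i = applySign (sign i) (ℕ→F ℤ.∣ i ∣)

    ℤ→F-◃ : ∀ s n → ℤ→F (s ◃ n) ≡ applySign s (ℕ→F n)
    ℤ→F-◃ Sign.- zero    = sym -0#≈0#
    ℤ→F-◃ Sign.- (suc n) = refl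
    ℤ→F-◃ Sign.+ zero    = refl
    ℤ→F-◃ Sign.+ (suc n) = refl

    ℤ→F-⊖ : ∀ m n → ℤ→F (m ⊖ n) ≡ ℕ→F m − ℕ→F n
    ℤ→F-⊖ zero    zero    = sym (-‿inverseʳ _)
    ℤ→F-⊖ zero    (suc n) = sym (+-identityˡ _)
    ℤ→F-⊖ (suc m) zero    = sym (trans (cong (ℕ→F (suc m) +_) -0#≈0#) (+-identityʳ _))
    ℤ→F-⊖ (suc m) (suc n) =
      trans (cong ℤ→F (ℤP.[1+m]⊖[1+n]≡m⊖n m n)) (trans (ℤ→F-⊖ m n) (sym cancel-1#))
      where
      open ≡-Reasoning
      cancel-1# : (1# + ℕ→F m) − (1# + ℕ→F n) ≡ ℕ→F m − ℕ→F n
      cancel-1# = begin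
        (1# + ℕ→F m) + - (1# + ℕ→F n)   ≡⟨ cong ((1# + ℕ→F m) +_) (-‿+-comm 1# (ℕ→F n)) ⟨
        (1# + ℕ→F m) + (- 1# + - ℕ→F n) ≡⟨ +-assoc _ _ _ ⟩
        1# + (ℕ→F m + (- 1# + - ℕ→F n)) ≡⟨ cong (1# +_) (+-assoc _ _ _) ⟨
        1# + ((ℕ→F m + - 1#) + - ℕ→F n) ≡⟨ cong (λ z → 1# + (z + - ℕ→F n)) (+-comm _ _) ⟩
        1# + ((- 1# + ℕ→F m) + - ℕ→F n) ≡⟨ cong (1# +_) (+-assoc _ _ _) ⟩
        1# + (- 1# + (ℕ→F m − ℕ→F n))   ≡⟨ +-assoc _ _ _ ⟨
        (1# + - 1#) + (ℕ→F m − ℕ→F n)   ≡⟨ cong (_+ (ℕ→F m − ℕ→F n)) (-‿inverseʳ _) ⟩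
        0# + (ℕ→F m − ℕ→F n)            ≡⟨ +-identityˡ _ ⟩
        ℕ→F m − ℕ→F n                   ∎

    ℤ→F-+ : ∀ i j → ℤ→F (i ℤ.+ j) ≡ ℤ→F i + ℤ→F j
    ℤ→F-+ -[1+ m ] -[1+ n ] = trans (cong -_ ones) (sym (-‿+-comm _ _))
      where
      open ≡-Reasoning
      ones : 1# + (1# + ℕ→F (m ℕ.+ n)) ≡ (1# + ℕ→F m) + (1# + ℕ→F n)
      ones = begin
        1# + (1# + ℕ→F (m ℕ.+ n))   ≡⟨ cong (λ z → 1# + (1# + z)) (ℕ→F-+ m n) ⟩
        1# + (1# + (ℕ→F m + ℕ→F n)) ≡⟨ cong (1# +_) (+-assoc _ _ _) ⟨
        1# + ((1# + ℕ→F m) + ℕ→F n) ≡⟨ cong (λ z → 1# + (z + ℕ→F n)) (+-comm _ _) ⟩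
        1# + ((ℕ→F m + 1#) + ℕ→F n) ≡⟨ cong (1# +_) (+-assoc _ _ _) ⟩
        1# + (ℕ→F m + (1# + ℕ→F n)) ≡⟨ +-assoc _ _ _ ⟨
        (1# + ℕ→F m) + (1# + ℕ→F n) ∎
    ℤ→F-+ -[1+ m ] (ℤ.+ n)   = trans (ℤ→F-⊖ n (suc m)) (+-comm _ _)
    ℤ→F-+ (ℤ.+ m) -[1+ n ]   = ℤ→F-⊖ m (suc n)
    ℤ→F-+ (ℤ.+ m) (ℤ.+ n)    = ℕ→F-+ m n

    applySign-* : ∀ s t x y → applySign (s Sign.* t) (x * y) ≡ applySign s x * applySign t y
    applySign-* Sign.- Sign.- x y =
      sym (trans (sym (-‿distribˡ-* x (- y))) (trans (cong -_ (sym (-‿distribʳ-* x y))) (-‿involutive _)))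
    applySign-* Sign.- Sign.+ x y = -‿distribˡ-* x y
    applySign-* Sign.+ Sign.- x y = -‿distribʳ-* x y
    applySign-* Sign.+ Sign.+ x y = refl

    ℤ→F-* : ∀ i j → ℤ→F (i ℤ.* j) ≡ ℤ→F i * ℤ→F j
    ℤ→F-* i j = begin
      ℤ→F (i ℤ.* j)                                    ≡⟨ ℤ→F-◃ (sign i Sign.* sign j) (ℤ.∣ i ∣ ℕ.* ℤ.∣ j ∣) ⟩
      applySign (sign i Sign.* sign j) (ℕ→F (ℤ.∣ i ∣ ℕ.* ℤ.∣ j ∣))
        ≡⟨ cong (applySign (sign i Sign.* sign j)) (ℕ→F-* ℤ.∣ i ∣ ℤ.∣ j ∣) ⟩
      applySign (sign i Sign.* sign j) (ℕ→F ℤ.∣ i ∣ * ℕ→F ℤ.∣ j ∣) ≡⟨ applySign-* (sign i) (sign j) _ _ ⟩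
      ℤ→F i * ℤ→F j                                    ∎
      where open ≡-Reasoning

    ℤ→F-neg : ∀ i → ℤ→F (ℤ.- i) ≡ - ℤ→F i
    ℤ→F-neg -[1+ n ]       = sym (-‿involutive _)
    ℤ→F-neg (ℤ.+ zero)     = sym -0#≈0#
    ℤ→F-neg (ℤ.+ (suc n))  = refl

    homomorphism : ℤ.+-*-rawRing -Raw-AlmostCommutative⟶ fromCommutativeRing commutativeRing
    homomorphism = record
      { ⟦_⟧ = ℤ→F ; +-homo = ℤ→F-+ ; *-homo = ℤ→F-* ; -‿homo = ℤ→F-neg
      ; 0-homo = refl ; 1-homo = +-identityʳ 1# }

    ≡-if-ℤ-≡ : ∀ i j → Maybe (ℤ→F i ≡ ℤ→F j)
    ≡-if-ℤ-≡ i j with i ℤ.≟ j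
    ... | yes refl = just refl
    ... | no _     = nothing

  open import Algebra.Solver.Ring ℤ.+-*-rawRing (fromCommutativeRing commutativeRing)
    ℤ-Coefficients.homomorphism ℤ-Coefficients.≡-if-ℤ-≡

  -- Arithmetic in F

  *-cancelˡ : ∀ {x} → x ≢ 0# → ∀ y z → x * y ≡ x * z → y ≡ z
  *-cancelˡ {x} x≢0 y z xy≡xz = begin
    y                   ≡⟨ undo y ⟩
    x⁻¹ * (x * y)       ≡⟨ cong (x⁻¹ *_) xy≡xz ⟩
    x⁻¹ * (x * z)       ≡⟨ undo z ⟨
    z                   ∎
    where
    open ≡-Reasoning
    x⁻¹ = proj₁ (inverse x x≢0)
    undo : ∀ w → w ≡ x⁻¹ * (x * w)
    undo w = begin
      w               ≡⟨ *-identityˡ w ⟨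
      1# * w          ≡⟨ cong (_* w) (trans (*-comm x⁻¹ x) (proj₂ (inverse x x≢0))) ⟨
      (x⁻¹ * x) * w   ≡⟨ *-assoc _ _ _ ⟩
      x⁻¹ * (x * w)   ∎

  *-nonzero : ∀ {x y} → x ≢ 0# → y ≢ 0# → x * y ≢ 0#
  *-nonzero x≢0 y≢0 xy≡0 = y≢0 (*-cancelˡ x≢0 _ _ (trans xy≡0 (sym (zeroʳ _))))

  x−y≡0⇒x≡y : ∀ x y → x − y ≡ 0# → x ≡ y
  x−y≡0⇒x≡y x y x−y≡0 = begin
    x             ≡⟨ solve 2 (λ x y → x := (x :- y) :+ y) refl x y ⟩
    (x − y) + y   ≡⟨ cong (_+ y) x−y≡0 ⟩
    0# + y        ≡⟨ +-identityˡ y ⟩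
    y             ∎
    where open ≡-Reasoning

  x+y≡0⇒x≡-y : ∀ x y → x + y ≡ 0# → x ≡ - y
  x+y≡0⇒x≡-y x y x+y≡0 = x−y≡0⇒x≡y x (- y) (trans (cong (x +_) (-‿involutive y)) x+y≡0)

  x≢y⇒x−y≢0 : ∀ {x y} → x ≢ y → x − y ≢ 0#
  x≢y⇒x−y≢0 {x} {y} x≢y = x≢y ∘ x−y≡0⇒x≡y x y

  ^-distribˡ-+-* : ∀ x m n → x ^ (m ℕ.+ n) ≡ x ^ m * x ^ n
  ^-distribˡ-+-* x zero    n = sym (*-identityˡ _)
  ^-distribˡ-+-* x (suc m) n = trans (cong (x *_) (^-distribˡ-+-* x m n)) (sym (*-assoc _ _ _))

  ^-*-assoc : ∀ x m n → (x ^ m) ^ n ≡ x ^ (m ℕ.* n)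
  ^-*-assoc x m zero    = cong (x ^_) (sym (ℕP.*-zeroʳ m))
  ^-*-assoc x m (suc n) = begin
    x ^ m * (x ^ m) ^ n        ≡⟨ cong (x ^ m *_) (^-*-assoc x m n) ⟩
    x ^ m * x ^ (m ℕ.* n)      ≡⟨ ^-distribˡ-+-* x m (m ℕ.* n) ⟨
    x ^ (m ℕ.+ m ℕ.* n)        ≡⟨ cong (x ^_) (ℕP.*-suc m n) ⟨
    x ^ (m ℕ.* suc n)          ∎
    where open ≡-Reasoning

  0^n≡0 : ∀ e → 1 ℕ.≤ e → 0# ^ e ≡ 0#
  0^n≡0 (suc e) _ = zeroˡ _

  1+multiple≢multiple : ∀ u v s t → ℕ→F v ≡ 0# → ℕ→F t ≡ 0# → 1 ℕ.+ u ℕ.* v ≢ s ℕ.* t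
  1+multiple≢multiple u v s t v≡0 t≡0 eq = 0≢1 (begin
    0#                        ≡⟨ zeroʳ _ ⟨
    ℕ→F s * 0#                ≡⟨ cong (ℕ→F s *_) t≡0 ⟨
    ℕ→F s * ℕ→F t             ≡⟨ ℕ→F-* s t ⟨
    ℕ→F (s ℕ.* t)             ≡⟨ cong ℕ→F eq ⟨
    1# + ℕ→F (u ℕ.* v)        ≡⟨ cong (1# +_) (ℕ→F-* u v) ⟩
    1# + ℕ→F u * ℕ→F v        ≡⟨ cong (λ z → 1# + ℕ→F u * z) v≡0 ⟩
    1# + ℕ→F u * 0#           ≡⟨ cong (1# +_) (zeroʳ _) ⟩
    1# + 0#                   ≡⟨ +-identityʳ 1# ⟩
    1#                        ∎)
    where open ≡-Reasoning

  ℕ→F≡0⇒∣ : ∀ {p} → Prime p → ℕ→F p ≡ 0# → ∀ x → ℕ→F x ≡ 0# → p ∣ x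
  ℕ→F≡0⇒∣ {p} p-prime p≡0 x x≡0 = by-remainder (x % p) refl
    where
    instance _ = prime⇒nonZero p-prime
    open ≡-Reasoning
    remainder≡0 : ℕ→F (x % p) ≡ 0#
    remainder≡0 = begin
      ℕ→F (x % p)                              ≡⟨ +-identityʳ _ ⟨
      ℕ→F (x % p) + 0#                         ≡⟨ cong (ℕ→F (x % p) +_) (trans (cong (ℕ→F (x / p) *_) p≡0) (zeroʳ _)) ⟨
      ℕ→F (x % p) + ℕ→F (x / p) * ℕ→F p        ≡⟨ cong (ℕ→F (x % p) +_) (ℕ→F-* (x / p) p) ⟨
      ℕ→F (x % p) + ℕ→F (x / p ℕ.* p)          ≡⟨ ℕ→F-+ (x % p) _ ⟨
      ℕ→F (x % p ℕ.+ x / p ℕ.* p)              ≡⟨ cong ℕ→F (m≡m%n+[m/n]*n x p) ⟨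
      ℕ→F x                                    ≡⟨ x≡0 ⟩
      0#                                       ∎
    by-remainder : ∀ r → x % p ≡ r → p ∣ x
    by-remainder zero    x%p≡0 = m%n≡0⇒n∣m x p x%p≡0
    by-remainder (suc r) x%p≡r with coprime-Bézout (prime⇒coprime p-prime (subst (ℕ._< p) x%p≡r (m%n<n x p)))
    ... | Bézout.+- u v eq = ⊥-elim (1+multiple≢multiple v (suc r) u p (subst (λ z → ℕ→F z ≡ 0#) x%p≡r remainder≡0) p≡0 eq)
    ... | Bézout.-+ u v eq = ⊥-elim (1+multiple≢multiple u p v (suc r) p≡0 (subst (λ z → ℕ→F z ≡ 0#) x%p≡r remainder≡0) eq)

  -- Counting in F

  elements : List F
  elements = map elem (allFin q)

  elements-unique : Unique elements
  elements-unique = Unique.map⁺ elem-injective (Unique.allFin⁺ q)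
    where
    elem-injective : ∀ {i j} → elem i ≡ elem j → i ≡ j
    elem-injective {i} {j} e = trans (sym (Inverse.strictlyInverseʳ enum i))
                                 (trans (cong (Inverse.from enum) e) (Inverse.strictlyInverseʳ enum j))

  ∈-elements : ∀ x → x ∈ elements
  ∈-elements x = subst (_∈ elements) (Inverse.strictlyInverseˡ enum x) (∈-map⁺ elem (∈-allFin _))

  length-elements : length elements ≡ q
  length-elements = trans (ListP.length-map elem (allFin q)) (ListP.length-tabulate (λ i → i))

  members : Subset → List F
  members P = filterᵇ P elements

  ∣∣≡length-members : ∀ P → ∣ P ∣ ≡ length (members P)
  ∣∣≡length-members P = sym (trans (cong length (filterᵇ-map P elem (allFin q))) (ListP.length-map elem (filterᵇ (P ∘ elem) (allFin q))))

  members-unique : ∀ P → Unique (members P)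
  members-unique P = Unique.filter⁺ (T? ∘ P) elements-unique

  ∈-members⁻ : ∀ {P x} → x ∈ members P → P x ≡ true
  ∈-members⁻ {P} x∈ = Equivalence.to T-≡ (proj₂ (∈-filter⁻ (T? ∘ P) {xs = elements} x∈))

  length-members-∘-involution : (σ : F → F) → (∀ x → σ (σ x) ≡ x) →
                                ∀ P → length (members (P ∘ σ)) ≡ length (members P)
  length-members-∘-involution σ σσ≗id P = begin
    length (filterᵇ (P ∘ σ) elements)           ≡⟨ ListP.length-map σ (filterᵇ (P ∘ σ) elements) ⟨
    length (map σ (filterᵇ (P ∘ σ) elements))   ≡⟨ cong length (filterᵇ-map P σ elements) ⟨
    length (filterᵇ P (map σ elements))         ≡⟨ ↭-length (filter-↭ (T? ∘ P) σ-permutes) ⟩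
    length (filterᵇ P elements)                 ∎
    where
    open ≡-Reasoning
    σ-injective : ∀ {x y} → σ x ≡ σ y → x ≡ y
    σ-injective {x} {y} e = trans (sym (σσ≗id x)) (trans (cong σ e) (σσ≗id y))
    σ-permutes : map σ elements ↭ elements
    σ-permutes = unique-sameMembers⇒↭ _≟_ (Unique.map⁺ σ-injective elements-unique) elements-unique
      (λ _ → ∈-elements _) (λ {z} _ → subst (_∈ map σ elements) (σσ≗id z) (∈-map⁺ σ (∈-elements (σ z))))

  units : List F
  units = filter (Dec.¬? ∘ (_≟ 0#)) elements

  ∈-units⁺ : ∀ {x} → x ≢ 0# → x ∈ units
  ∈-units⁺ x≢0 = ∈-filter⁺ (Dec.¬? ∘ (_≟ 0#)) (∈-elements _) x≢0

  ∈-units⁻ : ∀ {x} → x ∈ units → x ≢ 0#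
  ∈-units⁻ x∈ = proj₂ (∈-filter⁻ (Dec.¬? ∘ (_≟ 0#)) {xs = elements} x∈)

  units-unique : Unique units
  units-unique = Unique.filter⁺ (Dec.¬? ∘ (_≟ 0#)) elements-unique

  length-units : length units ≡ q ∸ 1
  length-units = cong (_∸ 1) (trans (↭-length 0∷units↭elements) length-elements)
    where
    0∷units↭elements : 0# ∷ units ↭ elements
    0∷units↭elements = unique-sameMembers⇒↭ _≟_
      (All.tabulate (λ x∈ 0≡x → ∈-units⁻ x∈ (sym 0≡x)) ∷ units-unique) elements-unique
      (λ _ → ∈-elements _) back
      where
      back : ∀ {z} → z ∈ elements → z ∈ 0# ∷ units
      back {z} _ with z ≟ 0#
      ... | yes z≡0 = here z≡0
      ... | no  z≢0 = there (∈-units⁺ z≢0)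

  product : List F → F
  product = foldr _*_ 1#

  product-map-* : ∀ y xs → product (map (y *_) xs) ≡ y ^ length xs * product xs
  product-map-* y []       = sym (*-identityʳ 1#)
  product-map-* y (x ∷ xs) = trans (cong (y * x *_) (product-map-* y xs))
    (solve 4 (λ y x a b → y :* x :* (a :* b) := y :* a :* (x :* b)) refl y x (y ^ length xs) (product xs))

  product-nonzero : ∀ xs → (∀ {z} → z ∈ xs → z ≢ 0#) → product xs ≢ 0#
  product-nonzero []       _    = 0≢1 ∘ sym
  product-nonzero (x ∷ xs) all≢0 = *-nonzero (all≢0 (here refl)) (product-nonzero xs (all≢0 ∘ there))

  -- Multiplication by y permutes the units, so their product absorbs the factor y ^ (q - 1).
  fermat : ∀ {y} → y ≢ 0# → y ^ (q ∸ 1) ≡ 1#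
  fermat {y} y≢0 = subst (λ e → y ^ e ≡ 1#) length-units
    (*-cancelˡ (product-nonzero units ∈-units⁻) _ _ (begin
      product units * y ^ length units      ≡⟨ *-comm _ _ ⟩
      y ^ length units * product units      ≡⟨ product-map-* y units ⟨
      product (map (y *_) units)            ≡⟨ foldr-commMonoid (setoid F) *-isCommutativeMonoid (↭⇒↭ₛ y*-permutes) ⟩
      product units                         ≡⟨ *-identityʳ _ ⟨
      product units * 1#                    ∎))
    where
    open ≡-Reasoning
    y⁻¹ = proj₁ (inverse y y≢0)
    yy⁻¹≡1 = proj₂ (inverse y y≢0)
    y⁻¹≢0 : y⁻¹ ≢ 0#
    y⁻¹≢0 y⁻¹≡0 = 0≢1 (trans (sym (zeroʳ y)) (trans (cong (y *_) (sym y⁻¹≡0)) yy⁻¹≡1))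
    into : ∀ {z} → z ∈ map (y *_) units → z ∈ units
    into z∈ with w , w∈ , refl ← ∈-map⁻ (y *_) z∈ = ∈-units⁺ (*-nonzero y≢0 (∈-units⁻ w∈))
    onto : ∀ {z} → z ∈ units → z ∈ map (y *_) units
    onto {z} z∈ = subst (_∈ map (y *_) units) yy⁻¹z≡z (∈-map⁺ (y *_) (∈-units⁺ (*-nonzero y⁻¹≢0 (∈-units⁻ z∈))))
      where
      yy⁻¹z≡z : y * (y⁻¹ * z) ≡ z
      yy⁻¹z≡z = trans (sym (*-assoc _ _ _)) (trans (cong (_* z) yy⁻¹≡1) (*-identityˡ z))
    y*-permutes : map (y *_) units ↭ units
    y*-permutes = unique-sameMembers⇒↭ _≟_ (Unique.map⁺ (*-cancelˡ y≢0 _ _) units-unique) units-unique into onto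

  -- Sums and binomial coefficients

  ∑< : ℕ → (ℕ → F) → F
  ∑< zero    f = 0#
  ∑< (suc L) f = f 0 + ∑< L (f ∘ suc)

  syntax ∑< L (λ j → e) = ∑[ j < L ] e

  ∑<-cong : ∀ L {f g : ℕ → F} → (∀ j → j ℕ.< L → f j ≡ g j) → ∑< L f ≡ ∑< L g
  ∑<-cong zero    f≗g = refl
  ∑<-cong (suc L) f≗g = cong₂ _+_ (f≗g 0 (s≤s z≤n)) (∑<-cong L (λ j j<L → f≗g (suc j) (s≤s j<L)))

  ∑<-+ : ∀ L (f g : ℕ → F) → ∑[ j < L ] (f j + g j) ≡ ∑< L f + ∑< L g
  ∑<-+ zero    f g = sym (+-identityˡ 0#)
  ∑<-+ (suc L) f g = trans (cong (f 0 + g 0 +_) (∑<-+ L (f ∘ suc) (g ∘ suc)))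
    (solve 4 (λ a b c d → (a :+ b) :+ (c :+ d) := (a :+ c) :+ (b :+ d)) refl _ _ _ _)

  ∑<-*ˡ : ∀ L c (f : ℕ → F) → ∑[ j < L ] (c * f j) ≡ c * ∑< L f
  ∑<-*ˡ zero    c f = sym (zeroʳ c)
  ∑<-*ˡ (suc L) c f = trans (cong (c * f 0 +_) (∑<-*ˡ L c (f ∘ suc))) (sym (distribˡ _ _ _))

  ∑<-neg : ∀ L (f : ℕ → F) → ∑[ j < L ] (- f j) ≡ - ∑< L f
  ∑<-neg zero    f = sym -0#≈0#
  ∑<-neg (suc L) f = trans (cong (- f 0 +_) (∑<-neg L (f ∘ suc))) (-‿+-comm _ _)

  ∑<-0 : ∀ L (f : ℕ → F) → (∀ j → f j ≡ 0#) → ∑< L f ≡ 0#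
  ∑<-0 zero    f f≗0 = refl
  ∑<-0 (suc L) f f≗0 = trans (cong₂ _+_ (f≗0 0) (∑<-0 L (f ∘ suc) (f≗0 ∘ suc))) (+-identityˡ 0#)

  ∑<-extend : ∀ L L′ (f : ℕ → F) → (∀ j → L ℕ.≤ j → f j ≡ 0#) → L ℕ.≤ L′ → ∑< L′ f ≡ ∑< L f
  ∑<-extend zero    L′       f f≡0 _         = ∑<-0 L′ f (λ j → f≡0 j z≤n)
  ∑<-extend (suc L) (suc L′) f f≡0 (s≤s L≤L′) =
    cong (f 0 +_) (∑<-extend L L′ (f ∘ suc) (λ j L≤j → f≡0 (suc j) (s≤s L≤j)) L≤L′)

  ∑∈ : {A : Set} → List A → (A → F) → F
  ∑∈ []       f = 0#
  ∑∈ (x ∷ xs) f = f x + ∑∈ xs f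

  syntax ∑∈ xs (λ a → e) = ∑[ a ← xs ] e

  ∑∈-cong : {A : Set} (xs : List A) {f g : A → F} → (∀ {a} → a ∈ xs → f a ≡ g a) → ∑∈ xs f ≡ ∑∈ xs g
  ∑∈-cong []       f≗g = refl
  ∑∈-cong (x ∷ xs) f≗g = cong₂ _+_ (f≗g (here refl)) (∑∈-cong xs (f≗g ∘ there))

  ∑∈-*ˡ : {A : Set} (xs : List A) (c : F) (f : A → F) → ∑[ a ← xs ] (c * f a) ≡ c * ∑∈ xs f
  ∑∈-*ˡ []       c f = sym (zeroʳ c)
  ∑∈-*ˡ (x ∷ xs) c f = trans (cong (c * f x +_) (∑∈-*ˡ xs c f)) (sym (distribˡ _ _ _))

  ∑∈-0 : {A : Set} (xs : List A) (f : A → F) → (∀ {a} → a ∈ xs → f a ≡ 0#) → ∑∈ xs f ≡ 0#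
  ∑∈-0 []       f f≡0 = refl
  ∑∈-0 (x ∷ xs) f f≡0 = trans (cong₂ _+_ (f≡0 (here refl)) (∑∈-0 xs f (f≡0 ∘ there))) (+-identityˡ 0#)

  ∑∈-∑<-comm : {A : Set} (xs : List A) (L : ℕ) (f : A → ℕ → F) →
               ∑[ a ← xs ] ∑< L (f a) ≡ ∑[ j < L ] ∑[ a ← xs ] f a j
  ∑∈-∑<-comm []       L f = sym (∑<-0 L _ (λ _ → refl))
  ∑∈-∑<-comm (x ∷ xs) L f = trans (cong (∑< L (f x) +_) (∑∈-∑<-comm xs L f)) (sym (∑<-+ L _ _))

  ∑∈-single : {A : Set} {xs : List A} (f : A → F) {a : A} → Unique xs → a ∈ xs → (∀ {x} → x ∈ xs → x ≢ a → f x ≡ 0#) → ∑∈ xs f ≡ f a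
  ∑∈-single f (x≢xs ∷ _) (here refl) f≡0 =
    trans (cong (f _ +_) (∑∈-0 _ f (λ x∈ → f≡0 (there x∈) (λ x≡a → All.lookup x≢xs x∈ (sym x≡a))))) (+-identityʳ _)
  ∑∈-single f (x≢xs ∷ u) (there a∈) f≡0 =
    trans (cong₂ _+_ (f≡0 (here refl) (λ x≡a → All.lookup x≢xs a∈ x≡a)) (∑∈-single f u a∈ (f≡0 ∘ there))) (+-identityˡ _)

  binom : ℕ → ℕ → F
  binom n k = ℕ→F (n C k)

  binom-pascal : ∀ n k → binom (suc n) (suc k) ≡ binom n k + binom n (suc k)
  binom-pascal n k = trans (cong ℕ→F (sym (nCk+nC[k+1]≡[n+1]C[k+1] n k))) (ℕ→F-+ (n C k) (n C suc k))

  binom-> : ∀ n k → n ℕ.< k → binom n k ≡ 0#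
  binom-> n k n<k = cong ℕ→F (k>n⇒nCk≡0 n<k)

  binom-diag : ∀ n → binom n n ≡ 1#
  binom-diag n = trans (cong ℕ→F (nCn≡1 n)) (+-identityʳ 1#)

  binom-0 : ∀ n → binom n 0 ≡ 1#
  binom-0 n = trans (cong ℕ→F (nCk≡nC[n∸k] {0} {n} z≤n)) (binom-diag n)

  -- Where the binomial vanishes, the truncated exponent n ∸ suc k is harmless.
  binom-^-step : ∀ n k x → binom n (suc k) * (x * x ^ (n ∸ suc k)) ≡ binom n (suc k) * x ^ (n ∸ k)
  binom-^-step n k x with k ℕ.<? n
  ... | yes k<n = cong (λ e → binom n (suc k) * x ^ e) (sym (ℕP.+-∸-assoc 1 k<n))
  ... | no  k≮n = trans (vanish (x * x ^ (n ∸ suc k))) (sym (vanish (x ^ (n ∸ k))))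
    where
    vanish : ∀ y → binom n (suc k) * y ≡ 0#
    vanish y = trans (cong (_* y) (binom-> n (suc k) (s≤s (ℕP.≮⇒≥ {k} {n} k≮n)))) (zeroˡ y)

  -- Polynomials, Hasse derivatives and roots

  -- Polynomials are coefficient sequences; P i is the coefficient of X ^ i.
  Poly : Set
  Poly = ℕ → F

  DegreeBelow : ℕ → Poly → Set
  DegreeBelow L P = ∀ i → L ℕ.≤ i → P i ≡ 0#

  X* : Poly → Poly
  X* P zero    = 0#
  X* P (suc i) = P i

  mulLinear : F → Poly → Poly
  mulLinear c P i = X* P i − c * P i

  mulLinear-degree : ∀ {L} c {P} → DegreeBelow L P → DegreeBelow (suc L) (mulLinear c P)
  mulLinear-degree c P<L (suc i) (s≤s L≤i) =
    trans (cong₂ _−_ (P<L i L≤i) (cong (c *_) (P<L (suc i) (ℕP.m≤n⇒m≤1+n L≤i))))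
          (solve 1 (λ c → con (ℤ.+ 0) :- c :* con (ℤ.+ 0) := con (ℤ.+ 0)) refl c)

  hasseTerm : ℕ → Poly → F → ℕ → F
  hasseTerm k P b j = binom j k * P j * b ^ (j ∸ k)

  hasse : ℕ → ℕ → Poly → F → F
  hasse L k P b = ∑< L (hasseTerm k P b)

  hasse-extend : ∀ {L} L′ k {P} b → DegreeBelow L P → L ℕ.≤ L′ → hasse L′ k P b ≡ hasse L k P b
  hasse-extend {L} L′ k {P} b P<L = ∑<-extend L L′ (hasseTerm k P b) (λ j L≤j → begin
    binom j k * P j * b ^ (j ∸ k)   ≡⟨ cong (λ z → binom j k * z * b ^ (j ∸ k)) (P<L j L≤j) ⟩
    binom j k * 0# * b ^ (j ∸ k)    ≡⟨ solve 2 (λ x y → x :* con (ℤ.+ 0) :* y := con (ℤ.+ 0)) refl _ _ ⟩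
    0#                              ∎)
    where open ≡-Reasoning

  hasse-cong : ∀ L k {P Q} b → P ≗ Q → hasse L k P b ≡ hasse L k Q b
  hasse-cong L k b P≗Q = ∑<-cong L (λ j _ → cong (λ z → binom j k * z * b ^ (j ∸ k)) (P≗Q j))

  hasse-− : ∀ L k P R b → hasse L k (λ i → P i − R i) b ≡ hasse L k P b − hasse L k R b
  hasse-− L k P R b = trans
    (∑<-cong L (λ j _ → solve 4 (λ B p r x → B :* (p :- r) :* x := B :* p :* x :- B :* r :* x) refl
                                 (binom j k) (P j) (R j) (b ^ (j ∸ k))))
    (trans (∑<-+ L (hasseTerm k P b) (λ j → - hasseTerm k R b j)) (cong (hasse L k P b +_) (∑<-neg L (hasseTerm k R b))))

  hasse-∑ : ∀ L k (xs : List F) (w : F → F) (Q : F → Poly) b →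
            hasse L k (λ i → ∑[ a ← xs ] (w a * Q a i)) b ≡ ∑[ a ← xs ] (w a * hasse L k (Q a) b)
  hasse-∑ L k xs w Q b = begin
    ∑[ j < L ] (binom j k * ∑[ a ← xs ] (w a * Q a j) * b ^ (j ∸ k))
      ≡⟨ ∑<-cong L (λ j _ → pull-in j) ⟩
    ∑[ j < L ] ∑[ a ← xs ] (w a * hasseTerm k (Q a) b j)
      ≡⟨ ∑∈-∑<-comm xs L (λ a j → w a * hasseTerm k (Q a) b j) ⟨
    ∑[ a ← xs ] ∑[ j < L ] (w a * hasseTerm k (Q a) b j)
      ≡⟨ ∑∈-cong xs (λ {a} _ → ∑<-*ˡ L (w a) (hasseTerm k (Q a) b)) ⟩
    ∑[ a ← xs ] (w a * hasse L k (Q a) b) ∎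
    where
    open ≡-Reasoning
    pull-in : ∀ j → binom j k * ∑[ a ← xs ] (w a * Q a j) * b ^ (j ∸ k) ≡ ∑[ a ← xs ] (w a * hasseTerm k (Q a) b j)
    pull-in j = trans (solve 3 (λ B s x → B :* s :* x := (B :* x) :* s) refl (binom j k) _ (b ^ (j ∸ k)))
      (trans (sym (∑∈-*ˡ xs (binom j k * b ^ (j ∸ k)) (λ a → w a * Q a j)))
        (∑∈-cong xs (λ {a} _ → solve 4 (λ B x w q → (B :* x) :* (w :* q) := w :* (B :* q :* x)) refl
                                         (binom j k) (b ^ (j ∸ k)) (w a) (Q a j))))

  hasseTerm₀-X* : ∀ P b j → hasseTerm 0 (X* P) b (suc j) ≡ b * hasseTerm 0 P b j
  hasseTerm₀-X* P b j =
    solve 4 (λ w p b x → w :* p :* (b :* x) := b :* (w :* p :* x)) refl (ℕ→F 1) (P j) b (b ^ j)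

  hasseTermₛ-X* : ∀ k P b j → hasseTerm (suc k) (X* P) b (suc j) ≡ b * hasseTerm (suc k) P b j + hasseTerm k P b j
  hasseTermₛ-X* k P b j = begin
    binom (suc j) (suc k) * P j * x     ≡⟨ cong (λ z → z * P j * x) (binom-pascal j k) ⟩
    (A + B) * P j * x                   ≡⟨ solve 4 (λ A B p x → (A :+ B) :* p :* x := p :* (B :* x) :+ A :* p :* x) refl A B (P j) x ⟩
    P j * (B * x) + A * P j * x         ≡⟨ cong (λ z → P j * z + A * P j * x) (binom-^-step j k b) ⟨
    P j * (B * (b * y)) + A * P j * x   ≡⟨ cong (_+ A * P j * x) (solve 4 (λ p B b y → p :* (B :* (b :* y)) := b :* (B :* p :* y)) refl (P j) B b y) ⟩
    b * (B * P j * y) + A * P j * x     ∎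
    where
    open ≡-Reasoning
    A = binom j k
    B = binom j (suc k)
    x = b ^ (j ∸ k)
    y = b ^ (j ∸ suc k)

  hasse-mulLinear : ∀ L k c P b → DegreeBelow L P →
                    hasse (suc L) k (mulLinear c P) b ≡ ∑[ j < L ] hasseTerm k (X* P) b (suc j) − c * hasse L k P b
  hasse-mulLinear L k c P b P<L = begin
    ∑< (suc L) (hasseTerm k (mulLinear c P) b)
      ≡⟨ ∑<-cong (suc L) (λ j _ → split j) ⟩
    ∑[ j < suc L ] (hasseTerm k (X* P) b j − c * hasseTerm k P b j)
      ≡⟨ ∑<-+ (suc L) (hasseTerm k (X* P) b) (λ j → - (c * hasseTerm k P b j)) ⟩
    ∑< (suc L) (hasseTerm k (X* P) b) + ∑[ j < suc L ] (- (c * hasseTerm k P b j))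
      ≡⟨ cong₂ _+_ (cong (_+ shifted) (solve 2 (λ w x → w :* con (ℤ.+ 0) :* x := con (ℤ.+ 0)) refl (binom 0 k) (b ^ (0 ∸ k))))
                   (trans (∑<-neg (suc L) (λ j → c * hasseTerm k P b j))
                          (cong -_ (trans (∑<-*ˡ (suc L) c (hasseTerm k P b)) (cong (c *_) (hasse-extend (suc L) k b P<L (ℕP.n≤1+n L)))))) ⟩
    (0# + shifted) − c * hasse L k P b
      ≡⟨ cong (_− c * hasse L k P b) (+-identityˡ _) ⟩
    shifted − c * hasse L k P b ∎
    where
    open ≡-Reasoning
    shifted = ∑[ j < L ] hasseTerm k (X* P) b (suc j)
    split : ∀ j → hasseTerm k (mulLinear c P) b j ≡ hasseTerm k (X* P) b j − c * hasseTerm k P b j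
    split j = solve 5 (λ B s c p x → B :* (s :- c :* p) :* x := B :* s :* x :- c :* (B :* p :* x)) refl
                      (binom j k) (X* P j) c (P j) (b ^ (j ∸ k))

  hasse₀-mulLinear : ∀ L c P b → DegreeBelow L P → hasse (suc L) 0 (mulLinear c P) b ≡ (b − c) * hasse L 0 P b
  hasse₀-mulLinear L c P b P<L = trans (hasse-mulLinear L 0 c P b P<L)
    (trans (cong (_− c * hasse L 0 P b) (trans (∑<-cong L (λ j _ → hasseTerm₀-X* P b j)) (∑<-*ˡ L b (hasseTerm 0 P b))))
           (solve 3 (λ b c t → b :* t :- c :* t := (b :- c) :* t) refl b c (hasse L 0 P b)))

  hasseₛ-mulLinear : ∀ L k c P b → DegreeBelow L P →
                     hasse (suc L) (suc k) (mulLinear c P) b ≡ (b − c) * hasse L (suc k) P b + hasse L k P b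
  hasseₛ-mulLinear L k c P b P<L = trans (hasse-mulLinear L (suc k) c P b P<L)
    (trans (cong (_− c * hasse L (suc k) P b)
                 (trans (∑<-cong L (λ j _ → hasseTermₛ-X* k P b j))
                        (trans (∑<-+ L (λ j → b * hasseTerm (suc k) P b j) (hasseTerm k P b))
                               (cong (_+ hasse L k P b) (∑<-*ˡ L b (hasseTerm (suc k) P b))))))
           (solve 4 (λ b c t u → b :* t :+ u :- c :* t := (b :- c) :* t :+ u) refl b c (hasse L (suc k) P b) (hasse L k P b)))

  -- Synthetic division by X - c, reading the coefficients of P below index suc L.
  quotient : ℕ → F → Poly → Poly
  quotient L c P i = ∑[ t < L ∸ i ] (P (suc (i ℕ.+ t)) * c ^ t)

  quotient-degree : ∀ L c P → DegreeBelow L (quotient L c P)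
  quotient-degree L c P i L≤i = cong (λ n → ∑[ t < n ] (P (suc (i ℕ.+ t)) * c ^ t)) (ℕP.m≤n⇒m∸n≡0 L≤i)

  quotient-step : ∀ L c P → DegreeBelow (suc L) P → ∀ i → quotient L c P i ≡ P (suc i) + c * quotient L c P (suc i)
  quotient-step L c P P<L i with i ℕ.<? L
  ... | yes i<L = begin
    ∑< (L ∸ i) f                             ≡⟨ cong (λ n → ∑< n f) (ℕP.+-∸-assoc 1 i<L) ⟩
    f 0 + ∑< (L ∸ suc i) (f ∘ suc)           ≡⟨ cong₂ _+_ head tail ⟩
    P (suc i) + c * quotient L c P (suc i)   ∎
    where
    open ≡-Reasoning
    f : ℕ → F
    f t = P (suc (i ℕ.+ t)) * c ^ t
    head : f 0 ≡ P (suc i)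
    head = trans (*-identityʳ _) (cong (λ z → P (suc z)) (ℕP.+-identityʳ i))
    tail : ∑< (L ∸ suc i) (f ∘ suc) ≡ c * quotient L c P (suc i)
    tail = trans (∑<-cong (L ∸ suc i) (λ t _ →
                   trans (cong (λ z → P (suc z) * (c * c ^ t)) (ℕP.+-suc i t))
                         (solve 3 (λ p c x → p :* (c :* x) := c :* (p :* x)) refl (P (suc (suc i ℕ.+ t))) c (c ^ t))))
                 (∑<-*ˡ (L ∸ suc i) c (λ t → P (suc (suc i ℕ.+ t)) * c ^ t))
  ... | no i≮L = trans (quotient-degree L c P i L≤i)
    (sym (trans (cong₂ _+_ (P<L (suc i) (s≤s L≤i))
                           (trans (cong (c *_) (quotient-degree L c P (suc i) (ℕP.m≤n⇒m≤1+n L≤i))) (zeroʳ c)))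
                (+-identityˡ 0#)))
    where
    L≤i : L ℕ.≤ i
    L≤i = ℕP.≮⇒≥ i≮L

  factor-theorem : ∀ L c P → DegreeBelow (suc L) P → hasse (suc L) 0 P c ≡ 0# → P ≗ mulLinear c (quotient L c P)
  factor-theorem L c P P<L Pc≡0 zero = begin
    P 0                      ≡⟨ solve 2 (λ p x → p := (p :+ x) :- x) refl (P 0) cQ₀ ⟩
    (P 0 + cQ₀) − cQ₀        ≡⟨ cong (_− cQ₀) evaluation ⟩
    0# − cQ₀                 ∎
    where
    open ≡-Reasoning
    cQ₀ = c * quotient L c P 0
    evaluation : P 0 + cQ₀ ≡ 0#
    evaluation = trans (cong₂ _+_
      (sym (trans (*-identityʳ _) (trans (cong (_* P 0) (+-identityʳ 1#)) (*-identityˡ _))))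
      (trans (sym (∑<-*ˡ L c _)) (∑<-cong L (λ j _ →
        solve 3 (λ p c x → c :* (p :* x) := con (ℤ.+ 1) :* p :* (c :* x)) refl (P (suc j)) c (c ^ j))))) Pc≡0
  factor-theorem L c P P<L Pc≡0 (suc i) = begin
    P (suc i)                               ≡⟨ solve 2 (λ p x → p := (p :+ x) :- x) refl (P (suc i)) cQᵢ₊₁ ⟩
    (P (suc i) + cQᵢ₊₁) − cQᵢ₊₁             ≡⟨ cong (_− cQᵢ₊₁) (quotient-step L c P P<L i) ⟨
    quotient L c P i − cQᵢ₊₁                ∎
    where
    open ≡-Reasoning
    cQᵢ₊₁ = c * quotient L c P (suc i)

  VanishesToOrder : ℕ → Poly → F → ℕ → Set
  VanishesToOrder L P b r = ∀ k → k ℕ.< r → hasse L k P b ≡ 0#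

  vanishesToOrder-quotient : ∀ L c P Q b r → P ≗ mulLinear c Q → DegreeBelow L Q → b ≢ c →
                             VanishesToOrder (suc L) P b r → VanishesToOrder L Q b r
  vanishesToOrder-quotient L c P Q b r P≗ Q<L b≢c P-vanishes = Q-vanishes
    where
    cancel : ∀ x → (b − c) * x ≡ 0# → x ≡ 0#
    cancel x e = *-cancelˡ (x≢y⇒x−y≢0 b≢c) x 0# (trans e (sym (zeroʳ _)))
    Q-vanishes : VanishesToOrder L Q b r
    Q-vanishes zero    0<r = cancel _ (begin
      (b − c) * hasse L 0 Q b            ≡⟨ hasse₀-mulLinear L c Q b Q<L ⟨
      hasse (suc L) 0 (mulLinear c Q) b  ≡⟨ hasse-cong (suc L) 0 b P≗ ⟨
      hasse (suc L) 0 P b                ≡⟨ P-vanishes 0 0<r ⟩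
      0#                                 ∎)
      where open ≡-Reasoning
    Q-vanishes (suc k) k<r = cancel _ (begin
      (b − c) * hasse L (suc k) Q b                         ≡⟨ +-identityʳ _ ⟨
      (b − c) * hasse L (suc k) Q b + 0#
        ≡⟨ cong ((b − c) * hasse L (suc k) Q b +_) (Q-vanishes k (ℕP.<-trans (ℕP.n<1+n k) k<r)) ⟨
      (b − c) * hasse L (suc k) Q b + hasse L k Q b         ≡⟨ hasseₛ-mulLinear L k c Q b Q<L ⟨
      hasse (suc L) (suc k) (mulLinear c Q) b               ≡⟨ hasse-cong (suc L) (suc k) b P≗ ⟨
      hasse (suc L) (suc k) P b                             ≡⟨ P-vanishes (suc k) k<r ⟩
      0#                                                    ∎)
      where open ≡-Reasoning

  vanishesToOrder-quotient-root : ∀ L c P Q r → P ≗ mulLinear c Q → DegreeBelow L Q →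
                                  VanishesToOrder (suc L) P c (suc r) → VanishesToOrder L Q c r
  vanishesToOrder-quotient-root L c P Q r P≗ Q<L P-vanishes k k<r = begin
    hasse L k Q c                                     ≡⟨ solve 2 (λ c t → t := (c :- c) :* con (ℤ.+ 0) :+ t) refl c _ ⟩
    (c − c) * 0# + hasse L k Q c                      ≡⟨ cong (λ z → z * 0# + hasse L k Q c) (-‿inverseʳ c) ⟩
    0# * 0# + hasse L k Q c                           ≡⟨ cong (_+ hasse L k Q c) (trans (zeroˡ 0#) (sym (zeroˡ _))) ⟩
    0# * hasse L (suc k) Q c + hasse L k Q c          ≡⟨ cong (λ z → z * hasse L (suc k) Q c + hasse L k Q c) (-‿inverseʳ c) ⟨
    (c − c) * hasse L (suc k) Q c + hasse L k Q c     ≡⟨ hasseₛ-mulLinear L k c Q c Q<L ⟨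
    hasse (suc L) (suc k) (mulLinear c Q) c           ≡⟨ hasse-cong (suc L) (suc k) c P≗ ⟨
    hasse (suc L) (suc k) P c                         ≡⟨ P-vanishes (suc k) (s≤s k<r) ⟩
    0#                                                ∎
    where open ≡-Reasoning

  Roots : ℕ → Poly → List (F × ℕ) → Set
  Roots L P ρ = Unique (map proj₁ ρ) × All (λ (b , r) → VanishesToOrder L P b r) ρ

  roots-quotient : ∀ L c P Q ρ → P ≗ mulLinear c Q → DegreeBelow L Q → All (c ≢_) (map proj₁ ρ) →
                   All (λ (b , r) → VanishesToOrder (suc L) P b r) ρ → All (λ (b , r) → VanishesToOrder L Q b r) ρ
  roots-quotient L c P Q []             P≗ Q<L _            []       = []
  roots-quotient L c P Q ((b , r) ∷ ρ)  P≗ Q<L (c≢b ∷ c≢ρ) (v ∷ vs) =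
    vanishesToOrder-quotient L c P Q b r P≗ Q<L (c≢b ∘ sym) v ∷ roots-quotient L c P Q ρ P≗ Q<L c≢ρ vs

  -- Divide out one root at a time; the total order drops by one with the degree bound.
  too-many-roots⇒zero : ∀ L P → DegreeBelow L P → ∀ ρ → Roots L P ρ → L ℕ.≤ sum (map proj₂ ρ) → P ≗ const 0#
  too-many-roots⇒zero zero    P P<0 ρ _ _ i = P<0 i z≤n
  too-many-roots⇒zero (suc L) P P<L ((b , zero) ∷ ρ) (_ ∷ u , _ ∷ vs) L≤ = too-many-roots⇒zero (suc L) P P<L ρ (u , vs) L≤
  too-many-roots⇒zero (suc L) P P<L ((b , suc r) ∷ ρ) (b≢ρ ∷ u , v ∷ vs) (s≤s L≤) i = begin
    P i                              ≡⟨ P≗ i ⟩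
    X* Q i − b * Q i                 ≡⟨ cong₂ (λ s t → s − b * t) (X*Q≡0 i) (Q≡0 i) ⟩
    0# − b * 0#                      ≡⟨ solve 1 (λ b → con (ℤ.+ 0) :- b :* con (ℤ.+ 0) := con (ℤ.+ 0)) refl b ⟩
    0#                               ∎
    where
    open ≡-Reasoning
    Q = quotient L b P
    P≗ : P ≗ mulLinear b Q
    P≗ = factor-theorem L b P P<L (v 0 (s≤s z≤n))
    Q<L : DegreeBelow L Q
    Q<L = quotient-degree L b P
    Q≡0 : Q ≗ const 0#
    Q≡0 = too-many-roots⇒zero L Q Q<L ((b , r) ∷ ρ)
            (b≢ρ ∷ u , vanishesToOrder-quotient-root L b P Q r P≗ Q<L v ∷ roots-quotient L b P Q ρ P≗ Q<L b≢ρ vs) L≤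
    X*Q≡0 : X* Q ≗ const 0#
    X*Q≡0 zero    = refl
    X*Q≡0 (suc i) = Q≡0 i

  rootsWithOrders : (F → ℕ) → List F → List (F × ℕ)
  rootsWithOrders r = map (λ b → b , r b)

  rootsWithOrders-Roots : ∀ {L P} r bs → Unique bs → (∀ {b} → b ∈ bs → VanishesToOrder L P b (r b)) →
                          Roots L P (rootsWithOrders r bs)
  rootsWithOrders-Roots r bs bs-unique vanishes =
    subst Unique (trans (sym (ListP.map-id bs)) (ListP.map-∘ bs)) bs-unique ,
    AllP.map⁺ (All.tabulate vanishes)

  sum-orders : ∀ r bs → sum (map proj₂ (rootsWithOrders r bs)) ≡ sum (map r bs)
  sum-orders r bs = cong sum (sym (ListP.map-∘ bs))

  -- Lagrange interpolation

  one : Poly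
  one zero    = 1#
  one (suc _) = 0#

  one-degree : DegreeBelow 1 one
  one-degree (suc i) _ = refl

  hasse₀-one : ∀ x → hasse 1 0 one x ≡ 1#
  hasse₀-one x = trans (+-identityʳ _) (trans (*-identityʳ _) (trans (*-identityʳ _) (+-identityʳ 1#)))

  hasseₛ-one : ∀ k x → hasse 1 (suc k) one x ≡ 0#
  hasseₛ-one k x = trans (+-identityʳ _) (trans (cong (λ z → z * 1# * 1#) (binom-> 0 (suc k) (s≤s z≤n)))
                                                (solve 1 (λ o → con (ℤ.+ 0) :* o :* o := con (ℤ.+ 0)) refl 1#))

  ∏Linear : List F → Poly
  ∏Linear []      = one
  ∏Linear (s ∷ S) = mulLinear s (∏Linear S)

  ∏Linear-degree : ∀ S → DegreeBelow (suc (length S)) (∏Linear S)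
  ∏Linear-degree []      = one-degree
  ∏Linear-degree (s ∷ S) = mulLinear-degree s (∏Linear-degree S)

  ∏Linear-monic : ∀ S → ∏Linear S (length S) ≡ 1#
  ∏Linear-monic []      = refl
  ∏Linear-monic (s ∷ S) = begin
    ∏Linear S (length S) − s * ∏Linear S (suc (length S))
      ≡⟨ cong₂ (λ u v → u − s * v) (∏Linear-monic S) (∏Linear-degree S _ ℕP.≤-refl) ⟩
    1# − s * 0#                                             ≡⟨ solve 2 (λ o s → o :- s :* con (ℤ.+ 0) := o) refl 1# s ⟩
    1#                                                      ∎
    where open ≡-Reasoning

  ∏Linear-root : ∀ S {x} → x ∈ S → hasse (suc (length S)) 0 (∏Linear S) x ≡ 0#
  ∏Linear-root (s ∷ S) {x} x∈ = trans (hasse₀-mulLinear (suc (length S)) s (∏Linear S) x (∏Linear-degree S)) (at x∈)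
    where
    at : x ∈ s ∷ S → (x − s) * hasse (suc (length S)) 0 (∏Linear S) x ≡ 0#
    at (here x≡s) = trans (cong (_* hasse (suc (length S)) 0 (∏Linear S) x) (trans (cong (_− s) x≡s) (-‿inverseʳ s))) (zeroˡ _)
    at (there x∈S) = trans (cong ((x − s) *_) (∏Linear-root S x∈S)) (zeroʳ _)

  ∏Linear-nonroot : ∀ S {x} → All (x ≢_) S → hasse (suc (length S)) 0 (∏Linear S) x ≢ 0#
  ∏Linear-nonroot []      {x} _            = subst (_≢ 0#) (sym (hasse₀-one x)) (0≢1 ∘ sym)
  ∏Linear-nonroot (s ∷ S) {x} (x≢s ∷ x≢S) =
    subst (_≢ 0#) (sym (hasse₀-mulLinear (suc (length S)) s (∏Linear S) x (∏Linear-degree S)))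
          (*-nonzero (x≢y⇒x−y≢0 x≢s) (∏Linear-nonroot S x≢S))

  module Lagrange (As : List F) (As-unique : Unique As) where
    n : ℕ
    n = length As

    others : F → List F
    others a = filter (Dec.¬? ∘ (_≟ a)) As

    others-excludes : ∀ a → All (a ≢_) (others a)
    others-excludes a = All.tabulate (λ x∈ a≡x → proj₂ (∈-filter⁻ (Dec.¬? ∘ (_≟ a)) {xs = As} x∈) (sym a≡x))

    ∈-others : ∀ {a x} → x ∈ As → x ≢ a → x ∈ others a
    ∈-others {a} = ∈-filter⁺ (Dec.¬? ∘ (_≟ a))

    length-others : ∀ {a} → a ∈ As → suc (length (others a)) ≡ n
    length-others {a} a∈ = ↭-length (unique-sameMembers⇒↭ _≟_
      (others-excludes a ∷ Unique.filter⁺ (Dec.¬? ∘ (_≟ a)) As-unique) As-unique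
      (λ { (here refl) → a∈ ; (there x∈) → proj₁ (∈-filter⁻ (Dec.¬? ∘ (_≟ a)) {xs = As} x∈) })
      back)
      where
      back : ∀ {x} → x ∈ As → x ∈ a ∷ others a
      back {x} x∈ with x ≟ a
      ... | yes x≡a = here x≡a
      ... | no  x≢a = there (∈-others x∈ x≢a)

    basis : F → Poly
    basis a = ∏Linear (others a)

    basis-degree : ∀ {a} → a ∈ As → DegreeBelow n (basis a)
    basis-degree {a} a∈ i n≤i = ∏Linear-degree (others a) i (subst (ℕ._≤ i) (sym (length-others a∈)) n≤i)

    hasse₀-basis : ∀ {a} → a ∈ As → ∀ x → hasse n 0 (basis a) x ≡ hasse (suc (length (others a))) 0 (basis a) x
    hasse₀-basis {a} a∈ x = hasse-extend n 0 x (∏Linear-degree (others a)) (ℕP.≤-reflexive (length-others a∈))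

    basis-at-other : ∀ {a x} → a ∈ As → x ∈ As → x ≢ a → hasse n 0 (basis a) x ≡ 0#
    basis-at-other {a} a∈ x∈ x≢a = trans (hasse₀-basis a∈ _) (∏Linear-root (others a) (∈-others x∈ x≢a))

    basis-at-self : ∀ {a} → a ∈ As → hasse n 0 (basis a) a ≢ 0#
    basis-at-self {a} a∈ = subst (_≢ 0#) (sym (hasse₀-basis a∈ a)) (∏Linear-nonroot (others a) (others-excludes a))

    basis-monic : ∀ {a} → a ∈ As → basis a (n ∸ 1) ≡ 1#
    basis-monic {a} a∈ = subst (λ i → basis a i ≡ 1#) (cong (_∸ 1) (length-others a∈)) (∏Linear-monic (others a))

    -- The first case happens only off As.
    weight : F → F
    weight a with hasse n 0 (basis a) a ≟ 0#
    ... | yes _ = 0#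
    ... | no  ≢0 = proj₁ (inverse _ ≢0)

    weight-inverse : ∀ {a} → a ∈ As → weight a * hasse n 0 (basis a) a ≡ 1#
    weight-inverse {a} a∈ with hasse n 0 (basis a) a ≟ 0#
    ... | yes ≡0 = ⊥-elim (basis-at-self a∈ ≡0)
    ... | no  ≢0 = trans (*-comm _ _) (proj₂ (inverse _ ≢0))

    interpolates : ∀ (v : F → F) {x} → x ∈ As → ∑[ a ← As ] (weight a * v a * hasse n 0 (basis a) x) ≡ v x
    interpolates v {x} x∈ = begin
      ∑[ a ← As ] (weight a * v a * hasse n 0 (basis a) x)  ≡⟨ ∑∈-single _ As-unique x∈ other-vanishes ⟩
      weight x * v x * hasse n 0 (basis x) x                ≡⟨ solve 3 (λ c t e → c :* t :* e := (c :* e) :* t) refl (weight x) (v x) _ ⟩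
      weight x * hasse n 0 (basis x) x * v x                ≡⟨ cong (_* v x) (weight-inverse x∈) ⟩
      1# * v x                                              ≡⟨ *-identityˡ _ ⟩
      v x                                                   ∎
      where
      open ≡-Reasoning
      other-vanishes : ∀ {a} → a ∈ As → a ≢ x → weight a * v a * hasse n 0 (basis a) x ≡ 0#
      other-vanishes a∈ a≢x = trans (cong (weight _ * v _ *_) (basis-at-other a∈ x∈ (a≢x ∘ sym))) (zeroʳ _)

    -- g - Σ_a weight a * g(a) * basis a has degree < n and vanishes on As, so it is zero.
    lagrange : ∀ g → DegreeBelow n g → ∑[ a ← As ] (weight a * hasse n 0 g a) ≡ g (n ∸ 1)
    lagrange g g<n = sym (x−y≡0⇒x≡y _ _ (trans (cong (g (n ∸ 1) −_) (sym leading)) (h≡0 (n ∸ 1))))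
      where
      G : F → F
      G = hasse n 0 g
      w : F → F
      w a = weight a * G a
      h : Poly
      h i = g i − ∑[ a ← As ] (w a * basis a i)
      h<n : DegreeBelow n h
      h<n i n≤i = trans (cong₂ _−_ (g<n i n≤i) (∑∈-0 As _ (λ a∈ → trans (cong (w _ *_) (basis-degree a∈ i n≤i)) (zeroʳ _))))
                        (solve 0 (con (ℤ.+ 0) :- con (ℤ.+ 0) := con (ℤ.+ 0)) refl)
      h-root : ∀ {x} → x ∈ As → VanishesToOrder n h x 1
      h-root {x} x∈ zero _ = begin
        hasse n 0 h x                                            ≡⟨ hasse-− n 0 g _ x ⟩
        G x − hasse n 0 (λ i → ∑[ a ← As ] (w a * basis a i)) x  ≡⟨ cong (G x −_) (hasse-∑ n 0 As w basis x) ⟩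
        G x − ∑[ a ← As ] (w a * hasse n 0 (basis a) x)          ≡⟨ cong (G x −_) (interpolates G x∈) ⟩
        G x − G x                                                ≡⟨ -‿inverseʳ _ ⟩
        0#                                                       ∎
        where open ≡-Reasoning
      h-root x∈ (suc k) (s≤s ())
      h≡0 : h ≗ const 0#
      h≡0 = too-many-roots⇒zero n h h<n (rootsWithOrders (const 1) As)
              (rootsWithOrders-Roots {n} {h} (const 1) As As-unique h-root)
              (ℕP.≤-reflexive (sym (trans (sum-orders (const 1) As) (sum-map-const As))))
        where
        sum-map-const : ∀ xs → sum (map (const 1) xs) ≡ length xs
        sum-map-const []       = refl
        sum-map-const (_ ∷ xs) = cong suc (sum-map-const xs)
      leading : ∑[ a ← As ] (w a * basis a (n ∸ 1)) ≡ ∑∈ As w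
      leading = ∑∈-cong As (λ a∈ → trans (cong (w _ *_) (basis-monic a∈)) (*-identityʳ _))

  -- The auxiliary polynomial

  linearPower : F → ℕ → Poly
  linearPower a zero    = one
  linearPower a (suc N) = mulLinear (- a) (linearPower a N)

  linearPower-degree : ∀ a N → DegreeBelow (suc N) (linearPower a N)
  linearPower-degree a zero    = one-degree
  linearPower-degree a (suc N) = mulLinear-degree (- a) (linearPower-degree a N)

  linearPower-coeff : ∀ a N i → linearPower a N i ≡ binom N i * a ^ (N ∸ i)
  linearPower-coeff a zero    zero    = sym (trans (*-identityʳ _) (+-identityʳ 1#))
  linearPower-coeff a zero    (suc i) = sym (zeroˡ _)
  linearPower-coeff a (suc N) zero    = begin
    0# − (- a) * linearPower a N 0     ≡⟨ cong (λ z → 0# − (- a) * z) (linearPower-coeff a N 0) ⟩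
    0# − (- a) * (binom N 0 * a ^ N)   ≡⟨ solve 3 (λ a o x → con (ℤ.+ 0) :- (:- a) :* (o :* x) := o :* (a :* x)) refl a (binom N 0) (a ^ N) ⟩
    binom N 0 * (a * a ^ N)            ≡⟨ cong (_* a ^ suc N) (trans (binom-0 N) (sym (binom-0 (suc N)))) ⟩
    binom (suc N) 0 * a ^ suc N        ∎
    where open ≡-Reasoning
  linearPower-coeff a (suc N) (suc i) = begin
    linearPower a N i − (- a) * linearPower a N (suc i)
      ≡⟨ cong₂ (λ u v → u − (- a) * v) (linearPower-coeff a N i) (linearPower-coeff a N (suc i)) ⟩
    A * x − (- a) * (B * y) ≡⟨ solve 5 (λ A x a B y → A :* x :- (:- a) :* (B :* y) := A :* x :+ B :* (a :* y)) refl A x a B y ⟩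
    A * x + B * (a * y)     ≡⟨ cong (A * x +_) (binom-^-step N i a) ⟩
    A * x + B * x           ≡⟨ solve 3 (λ A B x → A :* x :+ B :* x := (A :+ B) :* x) refl A B x ⟩
    (A + B) * x             ≡⟨ cong (_* x) (binom-pascal N i) ⟨
    binom (suc N) (suc i) * x ∎
    where
    open ≡-Reasoning
    A = binom N i
    B = binom N (suc i)
    x = a ^ (N ∸ i)
    y = a ^ (N ∸ suc i)

  hasse-linearPower : ∀ a N k b → hasse (suc N) k (linearPower a N) b ≡ binom N k * (a + b) ^ (N ∸ k)
  hasse-linearPower a zero    zero    b = trans (+-identityʳ _) (*-identityʳ _)
  hasse-linearPower a zero    (suc k) b = trans (+-identityʳ _) (trans (cong (_* _) (zeroˡ _)) (trans (zeroˡ _) (sym (zeroˡ _))))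
  hasse-linearPower a (suc N) zero    b = begin
    hasse (suc (suc N)) 0 (linearPower a (suc N)) b   ≡⟨ hasse₀-mulLinear (suc N) (- a) (linearPower a N) b (linearPower-degree a N) ⟩
    (b − - a) * hasse (suc N) 0 (linearPower a N) b   ≡⟨ cong ((b − - a) *_) (hasse-linearPower a N 0 b) ⟩
    (b − - a) * (binom N 0 * (a + b) ^ N)
      ≡⟨ solve 4 (λ a b o x → (b :- (:- a)) :* (o :* x) := o :* ((a :+ b) :* x)) refl a b (binom N 0) ((a + b) ^ N) ⟩
    binom N 0 * (a + b) ^ suc N                       ≡⟨ cong (_* (a + b) ^ suc N) (trans (binom-0 N) (sym (binom-0 (suc N)))) ⟩
    binom (suc N) 0 * (a + b) ^ suc N                 ∎
    where open ≡-Reasoning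
  hasse-linearPower a (suc N) (suc k) b = begin
    hasse (suc (suc N)) (suc k) (linearPower a (suc N)) b ≡⟨ hasseₛ-mulLinear (suc N) k (- a) (linearPower a N) b (linearPower-degree a N) ⟩
    (b − - a) * hasse (suc N) (suc k) (linearPower a N) b + hasse (suc N) k (linearPower a N) b
      ≡⟨ cong₂ (λ u v → (b − - a) * u + v) (hasse-linearPower a N (suc k) b) (hasse-linearPower a N k b) ⟩
    (b − - a) * (B * y) + A * x ≡⟨ solve 5 (λ a b B y Ax → (b :- (:- a)) :* (B :* y) :+ Ax := B :* ((a :+ b) :* y) :+ Ax) refl a b B y (A * x) ⟩
    B * ((a + b) * y) + A * x   ≡⟨ cong (_+ A * x) (binom-^-step N k (a + b)) ⟩
    B * x + A * x               ≡⟨ solve 3 (λ A B x → B :* x :+ A :* x := (A :+ B) :* x) refl A B x ⟩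
    (A + B) * x                 ≡⟨ cong (_* x) (binom-pascal N k) ⟨
    binom (suc N) (suc k) * x   ∎
    where
    open ≡-Reasoning
    A = binom N k
    B = binom N (suc k)
    x = (a + b) ^ (N ∸ k)
    y = (a + b) ^ (N ∸ suc k)

  module Auxiliary (As : List F) (As-unique : Unique As) (0<n : 0 ℕ.< length As) (m : ℕ) (0<m : 0 ℕ.< m) where
    open Lagrange As As-unique public

    N : ℕ
    N = n ∸ 1 ℕ.+ m

    n∸1<n : n ∸ 1 ℕ.< n
    n∸1<n = ℕP.∸-monoʳ-< {n} {1} {0} (s≤s z≤n) 0<n

    N∸m≡n∸1 : N ∸ m ≡ n ∸ 1
    N∸m≡n∸1 = ℕP.m+n∸n≡m (n ∸ 1) m

    weighted-power-sum : ∀ c j → j ℕ.< n → ∑[ a ← As ] (weight a * (c + a) ^ j) ≡ binom j (n ∸ 1) * c ^ (j ∸ (n ∸ 1))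
    weighted-power-sum c j j<n = begin
      ∑[ a ← As ] (weight a * (c + a) ^ j)                     ≡⟨ ∑∈-cong As (λ _ → cong (weight _ *_) evaluate) ⟩
      ∑[ a ← As ] (weight a * hasse n 0 (linearPower c j) a)
        ≡⟨ lagrange (linearPower c j) (λ i n≤i → linearPower-degree c j i (ℕP.≤-trans j<n n≤i)) ⟩
      linearPower c j (n ∸ 1)                                  ≡⟨ linearPower-coeff c j (n ∸ 1) ⟩
      binom j (n ∸ 1) * c ^ (j ∸ (n ∸ 1))                      ∎
      where
      open ≡-Reasoning
      evaluate : ∀ {a} → (c + a) ^ j ≡ hasse n 0 (linearPower c j) a
      evaluate {a} = sym (begin
        hasse n 0 (linearPower c j) a        ≡⟨ hasse-extend n 0 a (linearPower-degree c j) j<n ⟩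
        hasse (suc j) 0 (linearPower c j) a  ≡⟨ hasse-linearPower c j 0 a ⟩
        binom j 0 * (c + a) ^ j              ≡⟨ cong (_* (c + a) ^ j) (binom-0 j) ⟩
        1# * (c + a) ^ j                     ≡⟨ *-identityˡ _ ⟩
        (c + a) ^ j                          ∎)

    weightedPowers : Poly
    weightedPowers i = ∑[ a ← As ] (weight a * linearPower a N i)

    auxiliary : Poly
    auxiliary i = weightedPowers i − one i

    weightedPowers-coeff : ∀ i → m ℕ.≤ i →
      weightedPowers i ≡ binom N i * (binom (N ∸ i) (n ∸ 1) * 0# ^ (N ∸ i ∸ (n ∸ 1)))
    weightedPowers-coeff i m≤i = begin
      ∑[ a ← As ] (weight a * linearPower a N i)                  ≡⟨ ∑∈-cong As (λ {a} _ → reorder a) ⟩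
      ∑[ a ← As ] (binom N i * (weight a * (0# + a) ^ (N ∸ i)))   ≡⟨ ∑∈-*ˡ As (binom N i) (λ a → weight a * (0# + a) ^ (N ∸ i)) ⟩
      binom N i * ∑[ a ← As ] (weight a * (0# + a) ^ (N ∸ i))     ≡⟨ cong (binom N i *_) (weighted-power-sum 0# (N ∸ i) N∸i<n) ⟩
      binom N i * (binom (N ∸ i) (n ∸ 1) * 0# ^ (N ∸ i ∸ (n ∸ 1))) ∎
      where
      open ≡-Reasoning
      N∸i<n : N ∸ i ℕ.< n
      N∸i<n = ℕP.≤-<-trans (subst (N ∸ i ℕ.≤_) N∸m≡n∸1 (ℕP.∸-monoʳ-≤ N m≤i)) n∸1<n
      reorder : ∀ a → weight a * linearPower a N i ≡ binom N i * (weight a * (0# + a) ^ (N ∸ i))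
      reorder a = begin
        weight a * linearPower a N i                ≡⟨ cong (weight a *_) (linearPower-coeff a N i) ⟩
        weight a * (binom N i * a ^ (N ∸ i))        ≡⟨ cong (λ z → weight a * (binom N i * z ^ (N ∸ i))) (+-identityˡ a) ⟨
        weight a * (binom N i * (0# + a) ^ (N ∸ i)) ≡⟨ solve 3 (λ c B x → c :* (B :* x) := B :* (c :* x)) refl (weight a) (binom N i) _ ⟩
        binom N i * (weight a * (0# + a) ^ (N ∸ i)) ∎

    auxiliary-degree : DegreeBelow (suc m) auxiliary
    auxiliary-degree (suc i) (s≤s m≤i) =
      trans (cong (_− 0#) (trans (weightedPowers-coeff (suc i) (ℕP.m≤n⇒m≤1+n m≤i)) vanishes))
            (solve 0 (con (ℤ.+ 0) :- con (ℤ.+ 0) := con (ℤ.+ 0)) refl)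
      where
      vanishes : binom N (suc i) * (binom (N ∸ suc i) (n ∸ 1) * 0# ^ (N ∸ suc i ∸ (n ∸ 1))) ≡ 0#
      vanishes with N ℕ.<? suc i
      ... | yes N<i = trans (cong (_* (binom (N ∸ suc i) (n ∸ 1) * 0# ^ (N ∸ suc i ∸ (n ∸ 1)))) (binom-> N (suc i) N<i)) (zeroˡ _)
      ... | no  N≮i = trans (cong (λ z → binom N (suc i) * (z * 0# ^ (N ∸ suc i ∸ (n ∸ 1)))) (binom-> _ (n ∸ 1) below))
                            (trans (cong (binom N (suc i) *_) (zeroˡ _)) (zeroʳ _))
        where
        below : N ∸ suc i ℕ.< n ∸ 1
        below = subst (N ∸ suc i ℕ.<_) N∸m≡n∸1 (ℕP.∸-monoʳ-< {N} {suc i} {m} (s≤s m≤i) (ℕP.≮⇒≥ N≮i))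

    auxiliary-leading : auxiliary m ≡ binom N m
    auxiliary-leading = begin
      weightedPowers m − one m
        ≡⟨ cong₂ _−_ (weightedPowers-coeff m ℕP.≤-refl) (one-degree m 0<m) ⟩
      binom N m * (binom (N ∸ m) (n ∸ 1) * 0# ^ (N ∸ m ∸ (n ∸ 1))) − 0#
        ≡⟨ cong (λ e → binom N m * (binom e (n ∸ 1) * 0# ^ (e ∸ (n ∸ 1))) − 0#) N∸m≡n∸1 ⟩
      binom N m * (binom (n ∸ 1) (n ∸ 1) * 0# ^ (n ∸ 1 ∸ (n ∸ 1))) − 0#
        ≡⟨ cong₂ (λ u e → binom N m * (u * 0# ^ e) − 0#) (binom-diag (n ∸ 1)) (ℕP.n∸n≡0 (n ∸ 1)) ⟩
      binom N m * (1# * 1#) − 0#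
        ≡⟨ solve 2 (λ x o → x :* (o :* o) :- con (ℤ.+ 0) := x :* (o :* o)) refl (binom N m) 1# ⟩
      binom N m * (1# * 1#)
        ≡⟨ trans (cong (binom N m *_) (*-identityʳ 1#)) (*-identityʳ _) ⟩
      binom N m ∎
      where open ≡-Reasoning

    binomial-moment : ∀ k → k ℕ.< n → ∀ b →
      binom N k * (binom (n ∸ 1 ∸ k) (n ∸ 1) * b ^ (n ∸ 1 ∸ k ∸ (n ∸ 1))) ≡ hasse 1 k one b
    binomial-moment zero _ b = begin
      binom N 0 * (binom (n ∸ 1) (n ∸ 1) * b ^ (n ∸ 1 ∸ (n ∸ 1)))
        ≡⟨ cong₂ _*_ (binom-0 N) (cong₂ (λ u e → u * b ^ e) (binom-diag (n ∸ 1)) (ℕP.n∸n≡0 (n ∸ 1))) ⟩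
      1# * (1# * 1#)  ≡⟨ trans (*-identityˡ _) (*-identityˡ _) ⟩
      1#              ≡⟨ hasse₀-one b ⟨
      hasse 1 0 one b ∎
      where open ≡-Reasoning
    binomial-moment (suc k) k<n b = begin
      binom N (suc k) * (binom (n ∸ 1 ∸ suc k) (n ∸ 1) * b ^ (n ∸ 1 ∸ suc k ∸ (n ∸ 1)))
        ≡⟨ cong (λ u → binom N (suc k) * (u * b ^ (n ∸ 1 ∸ suc k ∸ (n ∸ 1)))) (binom-> _ (n ∸ 1) below) ⟩
      binom N (suc k) * (0# * b ^ (n ∸ 1 ∸ suc k ∸ (n ∸ 1)))
        ≡⟨ solve 2 (λ B x → B :* (con (ℤ.+ 0) :* x) := con (ℤ.+ 0)) refl (binom N (suc k)) _ ⟩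
      0#              ≡⟨ hasseₛ-one k b ⟨
      hasse 1 (suc k) one b ∎
      where
      open ≡-Reasoning
      below : n ∸ 1 ∸ suc k ℕ.< n ∸ 1
      below = ℕP.∸-monoʳ-< {n ∸ 1} {suc k} {0} (s≤s z≤n)
                (ℕP.≤-pred (subst (suc (suc k) ℕ.≤_) (sym (ℕP.m+[n∸m]≡n 0<n)) k<n))

    hasse-weightedPowers : ∀ b k → k ℕ.< n → (∀ {a} → a ∈ As → (a + b) ^ (N ∸ k) ≡ (a + b) ^ (n ∸ 1 ∸ k)) →
                           hasse (suc N) k weightedPowers b ≡ hasse 1 k one b
    hasse-weightedPowers b k k<n exponent-shift = begin
      hasse (suc N) k weightedPowers b                                   ≡⟨ hasse-∑ (suc N) k As weight (λ a → linearPower a N) b ⟩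
      ∑[ a ← As ] (weight a * hasse (suc N) k (linearPower a N) b)       ≡⟨ ∑∈-cong As lower-exponent ⟩
      ∑[ a ← As ] (binom N k * (weight a * (b + a) ^ j))                 ≡⟨ ∑∈-*ˡ As (binom N k) (λ a → weight a * (b + a) ^ j) ⟩
      binom N k * ∑[ a ← As ] (weight a * (b + a) ^ j)                   ≡⟨ cong (binom N k *_) (weighted-power-sum b j j<n) ⟩
      binom N k * (binom j (n ∸ 1) * b ^ (j ∸ (n ∸ 1)))                  ≡⟨ binomial-moment k k<n b ⟩
      hasse 1 k one b                                                    ∎
      where
      open ≡-Reasoning
      j = n ∸ 1 ∸ k
      j<n : j ℕ.< n
      j<n = ℕP.≤-<-trans (ℕP.m∸n≤m (n ∸ 1) k) n∸1<n
      lower-exponent : ∀ {a} → a ∈ As → weight a * hasse (suc N) k (linearPower a N) b ≡ binom N k * (weight a * (b + a) ^ j)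
      lower-exponent {a} a∈ = begin
        weight a * hasse (suc N) k (linearPower a N) b  ≡⟨ cong (weight a *_) (hasse-linearPower a N k b) ⟩
        weight a * (binom N k * (a + b) ^ (N ∸ k))
          ≡⟨ cong (λ z → weight a * (binom N k * z)) (trans (exponent-shift a∈) (cong (_^ j) (+-comm a b))) ⟩
        weight a * (binom N k * (b + a) ^ j)            ≡⟨ solve 3 (λ c B x → c :* (B :* x) := B :* (c :* x)) refl (weight a) (binom N k) _ ⟩
        binom N k * (weight a * (b + a) ^ j)            ∎

    auxiliary-vanishes : ∀ b k → k ℕ.< n → (∀ {a} → a ∈ As → (a + b) ^ (N ∸ k) ≡ (a + b) ^ (n ∸ 1 ∸ k)) →
                         hasse (suc m) k auxiliary b ≡ 0#
    auxiliary-vanishes b k k<n exponent-shift = begin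
      hasse (suc m) k auxiliary b
        ≡⟨ hasse-extend (suc N) k b auxiliary-degree (s≤s (ℕP.m≤n+m m (n ∸ 1))) ⟨
      hasse (suc N) k auxiliary b
        ≡⟨ hasse-− (suc N) k weightedPowers one b ⟩
      hasse (suc N) k weightedPowers b − hasse (suc N) k one b
        ≡⟨ cong₂ _−_ (hasse-weightedPowers b k k<n exponent-shift) (hasse-extend (suc N) k b one-degree (s≤s z≤n)) ⟩
      hasse 1 k one b − hasse 1 k one b
        ≡⟨ -‿inverseʳ _ ⟩
      0# ∎
      where open ≡-Reasoning

  -- Counting the roots on B

  members-cong : ∀ {P Q} → (∀ x → P x ≡ Q x) → members P ≡ members Q
  members-cong {P} {Q} P≗Q = ListP.filter-≐ (T? ∘ P) (T? ∘ Q)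
    ((λ {x} → subst T (P≗Q x)) , (λ {x} → subst T (sym (P≗Q x)))) elements

  q∸1≡d*m⇒0<m : ∀ d m → q ∸ 1 ≡ d ℕ.* m → 0 ℕ.< m
  q∸1≡d*m⇒0<m d (suc m) _       = s≤s z≤n
  q∸1≡d*m⇒0<m d zero    q∸1≡d*0 = ⊥-elim (ℕP.n≮0 (subst (0 ℕ.<_) |units|≡0 (nonempty (∈-units⁺ (0≢1 ∘ sym)))))
    where
    |units|≡0 : length units ≡ 0
    |units|≡0 = trans length-units (trans q∸1≡d*0 (ℕP.*-zeroʳ d))
    nonempty : ∀ {x : F} {xs} → x ∈ xs → 0 ℕ.< length xs
    nonempty (here _)  = s≤s z≤n
    nonempty (there _) = s≤s z≤n

  InS⇒^m≡1 : ∀ d m {x} → q ∸ 1 ≡ d ℕ.* m → InS d x → x ^ m ≡ 1#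
  InS⇒^m≡1 d m {x} q∸1≡d*m (y , y≢0 , y^d≡x) = begin
    x ^ m            ≡⟨ cong (_^ m) y^d≡x ⟨
    (y ^ d) ^ m      ≡⟨ ^-*-assoc y d m ⟩
    y ^ (d ℕ.* m)    ≡⟨ cong (y ^_) q∸1≡d*m ⟨
    y ^ (q ∸ 1)      ≡⟨ fermat y≢0 ⟩
    1#               ∎
    where open ≡-Reasoning

  ^-absorb : ∀ x j m k → k ℕ.≤ j → x ^ m ≡ 1# → x ^ (j ℕ.+ m ∸ k) ≡ x ^ (j ∸ k)
  ^-absorb x j m k k≤j x^m≡1 = begin
    x ^ (j ℕ.+ m ∸ k)        ≡⟨ cong (x ^_) (ℕP.+-∸-comm m k≤j) ⟩
    x ^ (j ∸ k ℕ.+ m)        ≡⟨ ^-distribˡ-+-* x (j ∸ k) m ⟩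
    x ^ (j ∸ k) * x ^ m      ≡⟨ cong (x ^ (j ∸ k) *_) x^m≡1 ⟩
    x ^ (j ∸ k) * 1#         ≡⟨ *-identityʳ _ ⟩
    x ^ (j ∸ k)              ∎
    where open ≡-Reasoning

  0^-absorb : ∀ j m k → k ℕ.< j → 0# ^ (j ℕ.+ m ∸ k) ≡ 0# ^ (j ∸ k)
  0^-absorb j m k k<j = trans (0^n≡0 (j ℕ.+ m ∸ k) (ℕP.≤-trans 0<j∸k (ℕP.∸-monoˡ-≤ k (ℕP.m≤m+n j m))))
                              (sym (0^n≡0 (j ∸ k) 0<j∸k))
    where
    0<j∸k : 0 ℕ.< j ∸ k
    0<j∸k = ℕP.m<n⇒0<n∸m k<j

  module _ {p d m : ℕ} (p-prime : Prime p) (p≡0 : ℕ→F p ≡ 0#) (q∸1≡d*m : q ∸ 1 ≡ d ℕ.* m) (A B : Subset)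
           (A+B⊆S : ∀ a b → A a ≡ true → B b ≡ true → (a + b ≡ 0#) ⊎ InS d (a + b)) where

    module WithSize (n′ : ℕ) (|A|≡1+n′ : length (members A) ≡ suc n′) where
      open Auxiliary (members A) (members-unique A) (subst (0 ℕ.<_) (sym |A|≡1+n′) (s≤s z≤n)) m (q∸1≡d*m⇒0<m d m q∸1≡d*m)

      order : F → ℕ
      order b = if A (- b) then n′ else suc n′

      n∸1≡n′ : n ∸ 1 ≡ n′
      n∸1≡n′ = cong (_∸ 1) |A|≡1+n′

      order≤1+n′ : ∀ b → order b ℕ.≤ suc n′
      order≤1+n′ b with A (- b)
      ... | true  = ℕP.n≤1+n n′
      ... | false = ℕP.≤-refl

      order-of-negated : ∀ {b} → A (- b) ≡ true → order b ≡ n′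
      order-of-negated A[-b] rewrite A[-b] = refl

      -- a + b lies in S_d, where x ^ m = 1, or is 0, which puts -b in A and so makes k < n - 1.
      exponent-shift : ∀ {b} → b ∈ members B → ∀ {k} → k ℕ.< order b → ∀ {a} → a ∈ members A →
                       (a + b) ^ (N ∸ k) ≡ (a + b) ^ (n ∸ 1 ∸ k)
      exponent-shift {b} b∈ {k} k<order {a} a∈ with A+B⊆S a b (∈-members⁻ a∈) (∈-members⁻ b∈)
      ... | inj₂ a+b∈S = ^-absorb (a + b) (n ∸ 1) m k k≤n∸1 (InS⇒^m≡1 d m q∸1≡d*m a+b∈S)
        where
        k≤n∸1 : k ℕ.≤ n ∸ 1
        k≤n∸1 = subst (k ℕ.≤_) (sym n∸1≡n′) (ℕP.≤-pred (ℕP.≤-trans k<order (order≤1+n′ b)))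
      ... | inj₁ a+b≡0 = subst (λ x → x ^ (N ∸ k) ≡ x ^ (n ∸ 1 ∸ k)) (sym a+b≡0) (0^-absorb (n ∸ 1) m k k<n∸1)
        where
        A[-b] : A (- b) ≡ true
        A[-b] = subst (λ x → A x ≡ true) (x+y≡0⇒x≡-y a b a+b≡0) (∈-members⁻ a∈)
        k<n∸1 : k ℕ.< n ∸ 1
        k<n∸1 = subst (k ℕ.<_) (trans (order-of-negated A[-b]) (sym n∸1≡n′)) k<order

      vanishes-on-B : ∀ {b} → b ∈ members B → VanishesToOrder (suc m) auxiliary b (order b)
      vanishes-on-B {b} b∈ k k<order = auxiliary-vanishes b k k<n (exponent-shift b∈ k<order)
        where
        k<n : k ℕ.< n
        k<n = subst (k ℕ.<_) (sym |A|≡1+n′) (ℕP.<-≤-trans k<order (order≤1+n′ b))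

      -- Otherwise F would vanish identically, but its coefficient of X ^ m is (N choose m).
      orders≤m : ¬ p ∣ (N C m) → sum (map order (members B)) ℕ.≤ m
      orders≤m p∤ with suc m ℕ.≤? sum (map order (members B))
      ... | no  orders≰m = ℕP.≤-pred (ℕP.≰⇒> orders≰m)
      ... | yes m<orders = ⊥-elim (p∤ (ℕ→F≡0⇒∣ p-prime p≡0 (N C m) (trans (sym auxiliary-leading) F≡0)))
        where
        F≡0 : auxiliary m ≡ 0#
        F≡0 = too-many-roots⇒zero (suc m) auxiliary auxiliary-degree (rootsWithOrders order (members B))
                (rootsWithOrders-Roots {suc m} {auxiliary} order (members B) (members-unique B) vanishes-on-B)
                (subst (suc m ℕ.≤_) (sym (sum-orders order (members B))) m<orders) m

      orders+|A∩-B|≡n|B| : sum (map order (members B)) ℕ.+ length (members (A ∩ neg B)) ≡ suc n′ ℕ.* length (members B)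
      orders+|A∩-B|≡n|B| = trans (cong (sum (map order (members B)) ℕ.+_) (sym negated-count))
                          (sum-if+length-filterᵇ (A ∘ -_) n′ (members B))
        where
        negated-count : length (filterᵇ (A ∘ -_) (members B)) ≡ length (members (A ∩ neg B))
        negated-count = begin
          length (filterᵇ (A ∘ -_) (members B))           ≡⟨ cong length (filterᵇ-filterᵇ B (A ∘ -_) elements) ⟩
          length (members (λ x → B x ∧ A (- x)))          ≡⟨ cong length (members-cong swap-and-negate) ⟩
          length (members ((A ∩ neg B) ∘ -_))             ≡⟨ length-members-∘-involution -_ -‿involutive (A ∩ neg B) ⟩
          length (members (A ∩ neg B))                    ∎
          where
          open ≡-Reasoning
          swap-and-negate : ∀ x → B x ∧ A (- x) ≡ A (- x) ∧ B (- (- x))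
          swap-and-negate x = trans (∧-comm (B x) (A (- x))) (cong (λ y → A (- x) ∧ B y) (sym (-‿involutive x)))

    sumset-bound : ¬ p ∣ ((∣ A ∣ ∸ 1 ℕ.+ m) C m) → ∣ A ∣ ℕ.* ∣ B ∣ ℕ.≤ m ℕ.+ ∣ A ∩ neg B ∣
    sumset-bound p∤ rewrite ∣∣≡length-members A | ∣∣≡length-members B | ∣∣≡length-members (A ∩ neg B)
      with length (members A) in |A|≡
    ... | zero   = z≤n
    ... | suc n′ = subst (ℕ._≤ m ℕ.+ length (members (A ∩ neg B))) (orders+|A∩-B|≡n|B| n′ |A|≡)
                     (ℕP.+-monoˡ-≤ (length (members (A ∩ neg B))) (orders≤m n′ |A|≡ p∤′))
      where
      open WithSize using (orders+|A∩-B|≡n|B|; orders≤m)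
      p∤′ : ¬ p ∣ ((length (members A) ∸ 1 ℕ.+ m) C m)
      p∤′ = subst (λ n → ¬ p ∣ ((n ∸ 1 ℕ.+ m) C m)) (sym |A|≡) p∤

open import Data.Nat using (_^_; _≤_; _<_; _+_; _*_)
open FiniteField using (0#; ℕ→F; Subset; ∣_∣; InS; neg; _∩_; add)

theorem1p1 : (p k q d m : ℕ) (𝔽 : FiniteField q) →
    Prime p → 1 ≤ k → q ≡ p ^ k → ℕ→F 𝔽 p ≡ 0# 𝔽 →
    1 < d → q ∸ 1 ≡ d * m →
    (A B : Subset 𝔽) →
    (∀ a b → A a ≡ true → B b ≡ true → (add 𝔽 a b ≡ 0# 𝔽) ⊎ InS 𝔽 d (add 𝔽 a b)) →
    ¬ (p ∣ ((∣_∣ 𝔽 A ∸ 1 + m) C m)) →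
    ∣_∣ 𝔽 A * ∣_∣ 𝔽 B ≤ m + ∣_∣ 𝔽 (_∩_ 𝔽 A (neg 𝔽 B))
theorem1p1 p k q d m 𝔽 p-prime _ _ p≡0 _ q∸1≡d*m A B A+B⊆S = sumset-bound 𝔽 {d = d} p-prime p≡0 q∸1≡d*m A B A+B⊆S
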